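{- Let $L$ be a finite family of nonempty finite sets (lists) and let $H=T(L)$ be its transversal hypergraph. Let $v_1\neq v_2$ be vertices of $H$ such that for every list $l\in L$, $v_1\in l$ if and only if $v_2\in l$. Then $v_1$ and $v_2$ are min-equal in $H$.
   Context: A transversal of a family of sets is a set meeting each member of the family. The transversal hypergraph $T(L)$ has as vertices the union of the lists of $L$ and as edges all transversals of $L$ of cardinality at most $|L|$. A minimal edge of a hypergraph is an edge that does not contain any other edge. Two distinct vertices $a,b$ of a hypergraph $H$ are min-equal if for every minimal edge $e$ of $H$: if $a\in e$ then $(e\setminus\{a\})\cup\{b\}$ is a minimal edge of $H$, and if $b\in e$ then $(e\setminus\{b\})\cup\{a\}$ is a minimal edge of $H$. -}

module Defs where

open import Data.Nat using (ℕ; _≤_)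
open import Data.Fin using (Fin)
open import Data.Fin.Subset using (Subset; _∈_; _⊆_; _∪_; _-_; ⁅_⁆; ∣_∣)
open import Data.Product using (Σ; ∃; _×_)
open import Relation.Binary.PropositionalEquality using (_≡_)
open import Relation.Nullary using (¬_)

-- A family L of m lists (finite sets) over the finite ground set Fin n,
-- given as an indexed family Fin m → Subset n; |L| = m.
Family : ℕ → ℕ → Set
Family m n = Fin m → Subset n

IsVertex : ∀ {m n} → Family m n → Fin n → Set
IsVertex {m} L x = Σ (Fin m) λ i → x ∈ L i

IsTransversal : ∀ {m n} → Family m n → Subset n → Set
IsTransversal {m} L t = (i : Fin m) → ∃ λ x → x ∈ t × x ∈ L i

IsEdge : ∀ {m n} → Family m n → Subset n → Set
IsEdge {m} L e = (∀ x → x ∈ e → IsVertex L x) × IsTransversal L e × ∣ e ∣ ≤ m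

IsMinEdge : ∀ {m n} → Family m n → Subset n → Set
IsMinEdge L e = IsEdge L e × (∀ e′ → IsEdge L e′ → e′ ⊆ e → e′ ≡ e)

MinEqual : ∀ {m n} → Family m n → Fin n → Fin n → Set
MinEqual L a b =
  ¬ (a ≡ b) ×
  (∀ e → IsMinEdge L e →
     (a ∈ e → IsMinEdge L ((e - a) ∪ ⁅ b ⁆)) ×
     (b ∈ e → IsMinEdge L ((e - b) ∪ ⁅ a ⁆)))

{-# OPTIONS --safe #-}
module Submission where

-- Write e[a ↦ b] for replace e a b = (e - a) ∪ ⁅ b ⁆, and let a ≢ b lie in the
-- same lists. Replacing a by b preserves transversals and does not increase the
-- size of a set containing a, so it maps edges containing a to edges. If e is a
-- minimal edge containing a and f ⊆ e[a ↦ b] is an edge, then b ∈ f (otherwise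
-- f ⊆ e, so f = e ∋ a, yet a ∉ e[a ↦ b]); hence the edge f[b ↦ a] lies in e and
-- equals it by minimality, which forces e[a ↦ b] ⊆ f.

open import Defs
open import Data.Nat using (ℕ; _≤_; _+_; suc; s≤s; z≤n)
open import Data.Nat.Properties using (≤-trans; ≤-reflexive; +-comm; +-suc; +-monoʳ-≤; n≤1+n; module ≤-Reasoning)
open import Data.Fin using (Fin; _≟_)
open import Data.Fin.Subset using (Subset; _∈_; _∉_; _⊆_; _─_; _-_; _∪_; ⁅_⁆; ∣_∣; inside; outside; Nonempty)
open import Data.Fin.Subset.Properties
  using (x∈⁅x⁆; x∈⁅y⁆⇒x≡y; ∣⁅x⁆∣≡1; p⊆p∪q; q⊆p∪q; x∈p∪q⁻; p─q⊆p; x∈p∧x≢y⇒x∈p-y;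
         x∈p⇒∣p-x∣<∣p∣; ⊆-reflexive; ⊆-antisym; _∈?_)
open import Data.Vec using ([]; _∷_; here; there)
open import Data.Product using (_×_; _,_; proj₁; proj₂)
open import Data.Sum using (_⊎_; inj₁; inj₂)
open import Relation.Nullary using (¬_; yes; no; contradiction)
open import Function using (_∘_)
open import Relation.Binary.PropositionalEquality using (_≡_; _≢_; refl; sym; cong; subst)

private
  variable
    m n : ℕ
    a b x : Fin n
    p q e : Subset n

x∈p─q⇒x∉q : x ∈ p ─ q → x ∉ q
x∈p─q⇒x∉q {p = _ ∷ _} {q = outside ∷ _} here ()
x∈p─q⇒x∉q {p = _ ∷ _} {q = _ ∷ _} (there x∈p─q) (there x∈q) = x∈p─q⇒x∉q x∈p─q x∈q

x∈p-y⇒x≢y : x ∈ p - a → x ≢ a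
x∈p-y⇒x≢y {a = a} x∈p-a refl = x∈p─q⇒x∉q x∈p-a (x∈⁅x⁆ a)

∣p∪q∣≤∣p∣+∣q∣ : (p q : Subset n) → ∣ p ∪ q ∣ ≤ ∣ p ∣ + ∣ q ∣
∣p∪q∣≤∣p∣+∣q∣ []            []            = z≤n
∣p∪q∣≤∣p∣+∣q∣ (inside  ∷ p) (inside  ∷ q) =
  s≤s (≤-trans (∣p∪q∣≤∣p∣+∣q∣ p q) (+-monoʳ-≤ ∣ p ∣ (n≤1+n ∣ q ∣)))
∣p∪q∣≤∣p∣+∣q∣ (inside  ∷ p) (outside ∷ q) = s≤s (∣p∪q∣≤∣p∣+∣q∣ p q)
∣p∪q∣≤∣p∣+∣q∣ (outside ∷ p) (inside  ∷ q) =
  ≤-trans (s≤s (∣p∪q∣≤∣p∣+∣q∣ p q)) (≤-reflexive (sym (+-suc ∣ p ∣ ∣ q ∣)))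
∣p∪q∣≤∣p∣+∣q∣ (outside ∷ p) (outside ∷ q) = ∣p∪q∣≤∣p∣+∣q∣ p q

replace : Subset n → Fin n → Fin n → Subset n
replace p a b = (p - a) ∪ ⁅ b ⁆

x∈replace⁻ : x ∈ replace p a b → (x ∈ p × x ≢ a) ⊎ x ≡ b
x∈replace⁻ {p = p} {a = a} {b = b} x∈ with x∈p∪q⁻ (p - a) ⁅ b ⁆ x∈
... | inj₁ x∈p-a = inj₁ (p─q⊆p p ⁅ a ⁆ x∈p-a , x∈p-y⇒x≢y x∈p-a)
... | inj₂ x∈⁅b⁆ = inj₂ (x∈⁅y⁆⇒x≡y b x∈⁅b⁆)

x∈replace⁺ : x ∈ p → x ≢ a → x ∈ replace p a b
x∈replace⁺ {b = b} x∈p x≢a = p⊆p∪q ⁅ b ⁆ (x∈p∧x≢y⇒x∈p-y x∈p x≢a)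

b∈replace : (p : Subset n) (a b : Fin n) → b ∈ replace p a b
b∈replace p a b = q⊆p∪q (p - a) ⁅ b ⁆ (x∈⁅x⁆ b)

a∉replace : a ≢ b → a ∉ replace p a b
a∉replace a≢b a∈ with x∈replace⁻ a∈
... | inj₁ (_ , a≢a) = a≢a refl
... | inj₂ a≡b       = a≢b a≡b

∣replace∣≤∣p∣ : a ∈ p → ∣ replace p a b ∣ ≤ ∣ p ∣
∣replace∣≤∣p∣ {a = a} {p = p} {b = b} a∈p = begin
  ∣ (p - a) ∪ ⁅ b ⁆ ∣    ≤⟨ ∣p∪q∣≤∣p∣+∣q∣ (p - a) ⁅ b ⁆ ⟩
  ∣ p - a ∣ + ∣ ⁅ b ⁆ ∣  ≡⟨ cong (∣ p - a ∣ +_) (∣⁅x⁆∣≡1 b) ⟩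
  ∣ p - a ∣ + 1          ≡⟨ +-comm ∣ p - a ∣ 1 ⟩
  suc ∣ p - a ∣          ≤⟨ x∈p⇒∣p-x∣<∣p∣ a∈p ⟩
  ∣ p ∣                  ∎
  where open ≤-Reasoning

⊆-replace⇒⊆ : p ⊆ replace q a b → b ∉ p → p ⊆ q
⊆-replace⇒⊆ p⊆ b∉p x∈p with x∈replace⁻ (p⊆ x∈p)
... | inj₁ (x∈q , _) = x∈q
... | inj₂ refl      = contradiction x∈p b∉p

⊆-replace⇒replace-⊆ : b ∈ q → p ⊆ replace q b a → replace p a b ⊆ q
⊆-replace⇒replace-⊆ b∈q p⊆ x∈ with x∈replace⁻ x∈
... | inj₂ refl            = b∈q
... | inj₁ (x∈p , x≢a) with x∈replace⁻ (p⊆ x∈p)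
...   | inj₁ (x∈q , _) = x∈q
...   | inj₂ x≡a       = contradiction x≡a x≢a

Star⊆ : Family m n → Fin n → Fin n → Set
Star⊆ {m} L a b = (i : Fin m) → a ∈ L i → b ∈ L i

module _ {L : Family m n} (a⇒b : Star⊆ L a b) where

  Star⊆⇒IsVertex : IsVertex L a → IsVertex L b
  Star⊆⇒IsVertex (i , a∈Li) = i , a⇒b i a∈Li

  replace-isTransversal : IsTransversal L p → IsTransversal L (replace p a b)
  replace-isTransversal {p = p} p-tr i with p-tr i
  ... | x , x∈p , x∈Li with x ≟ a
  ...   | yes refl = b , b∈replace p a b , a⇒b i x∈Li
  ...   | no x≢a   = x , x∈replace⁺ x∈p x≢a , x∈Li

  replace-isEdge : a ∈ e → IsEdge L e → IsEdge L (replace e a b)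
  replace-isEdge {e = e} a∈e (e-vert , e-tr , ∣e∣≤m) =
    vert , replace-isTransversal e-tr , ≤-trans (∣replace∣≤∣p∣ a∈e) ∣e∣≤m
    where
    vert : ∀ x → x ∈ replace e a b → IsVertex L x
    vert x x∈ with x∈replace⁻ x∈
    ... | inj₁ (x∈e , _) = e-vert x x∈e
    ... | inj₂ refl      = Star⊆⇒IsVertex (e-vert a a∈e)

replace-isMinEdge : {L : Family m n} → a ≢ b → Star⊆ L a b → Star⊆ L b a →
  IsMinEdge L e → a ∈ e → IsMinEdge L (replace e a b)
replace-isMinEdge {a = a} {b = b} {e = e} {L = L} a≢b a⇒b b⇒a (e-edge , e-min) a∈e =
  replace-isEdge a⇒b a∈e e-edge , minimal
  where
  minimal : ∀ f → IsEdge L f → f ⊆ replace e a b → f ≡ replace e a b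
  minimal f f-edge f⊆ with b ∈? f
  ... | no b∉f  = contradiction (f⊆ a∈f) (a∉replace a≢b)
    where
    a∈f : a ∈ f
    a∈f = subst (a ∈_) (sym (e-min f f-edge (⊆-replace⇒⊆ f⊆ b∉f))) a∈e
  ... | yes b∈f = ⊆-antisym f⊆ (⊆-replace⇒replace-⊆ b∈f (⊆-reflexive (sym f[b↦a]≡e)))
    where
    f[b↦a]≡e : replace f b a ≡ e
    f[b↦a]≡e = e-min (replace f b a) (replace-isEdge b⇒a b∈f f-edge)
                     (⊆-replace⇒replace-⊆ a∈e f⊆)

lemma7 : ∀ {m n} (L : Family m n) → (∀ i → Nonempty (L i)) →
    (v₁ v₂ : Fin n) → ¬ (v₁ ≡ v₂) → IsVertex L v₁ → IsVertex L v₂ →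
    (∀ i → (v₁ ∈ L i → v₂ ∈ L i) × (v₂ ∈ L i → v₁ ∈ L i)) →
    MinEqual L v₁ v₂
lemma7 L _ v₁ v₂ v₁≢v₂ _ _ same-lists = v₁≢v₂ , λ _ e-min →
    replace-isMinEdge v₁≢v₂ v₁⇒v₂ v₂⇒v₁ e-min
  , replace-isMinEdge (v₁≢v₂ ∘ sym) v₂⇒v₁ v₁⇒v₂ e-min
  where
  v₁⇒v₂ : Star⊆ L v₁ v₂
  v₁⇒v₂ i = proj₁ (same-lists i)
  v₂⇒v₁ : Star⊆ L v₂ v₁
  v₂⇒v₁ i = proj₂ (same-lists i)
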